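{- For $n=8$ teams there exists a feasible, single-break, ranking-fair schedule whose D-sequence is a cyclic rotation, or the reversal of a cyclic rotation, of $(2,2,2,1)$; i.e., the canonical pattern set allows a ranking-fair schedule for $n=8$.
   Context: Teams are $T=\{1,\dots,n\}$ ($n$ even), ranked by strength: team $i$ is stronger than team $j$ iff $i<j$. Rounds are $R=\{1,\dots,n-1\}$. A schedule assigns to each unordered pair of distinct teams a round in $R$ and designates which of the two plays at home (the other away). It is feasible if every team plays exactly one game in every round. The ranking HAP of team $i$ is the vector $(p_1,\dots,p_{n-1})$, $p_m\in\{H,A\}$ indicating whether team $i$ plays home or away against its $m$-th strongest opponent (opponents in increasing order of index). A schedule is ranking-fair if every team's ranking HAP alternates between $H$ and $A$. The HAP of a team is $(h_1,\dots,h_{n-1})$ with $h_r$ its venue in round $r$, read cyclically ($h_0:=h_{n-1}$); a team has a break in round $r$ if $h_{r-1}=h_r$. A schedule is single-break if every team has exactly one break. In a feasible single-break schedule the breaks occur in exactly $n/2$ distinct rounds $r_1<\dots<r_{n/2}$; the D-sequence is $(d_1,\dots,d_{n/2})$ with $d_i=r_{i+1}-r_i$ and $r_{n/2+1}:=r_1+n-1$. The canonical pattern set is the HAP set of a single-break schedule with D-sequence $(2,\dots,2,1)$ up to cyclic rotation and reversal. -}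

module Defs where

open import Data.Nat using (ℕ; zero; suc; _+_; _∸_)
open import Data.Fin using (Fin; zero; suc; toℕ; fromℕ; inject₁; _<_)
open import Data.Bool using (Bool)
open import Data.Vec using (Vec; []; _∷_; _∷ʳ_; reverse)
open import Data.Product using (Σ; ∃; _×_; _,_)
open import Data.Sum using (_⊎_)
open import Relation.Binary.PropositionalEquality using (_≡_; _≢_)
open import Relation.Nullary using (¬_)
open import Function using (_⇔_)

-- A schedule for n teams (Fin n; index 0 = strongest) and suc m rounds (Fin (suc m)).
-- rnd i j     : round in which the game between i and j is played
-- home i j    : true iff team i plays at home in its game against j
-- Values on the diagonal (i = j) are meaningless and never used.
record Schedule (n m : ℕ) : Set where
  field
    rnd       : Fin n → Fin n → Fin (suc m)
    home      : Fin n → Fin n → Bool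
    rnd-sym   : ∀ i j → rnd i j ≡ rnd j i
    home-anti : ∀ i j → i ≢ j → home i j ≢ home j i
open Schedule public

module _ {n m : ℕ} (s : Schedule n m) where

  Feasible : Set
  Feasible = ∀ (i : Fin n) (r : Fin (suc m)) →
    Σ (Fin n) λ j → j ≢ i × rnd s i j ≡ r ×
      (∀ j' → j' ≢ i → rnd s i j' ≡ r → j' ≡ j)

  Venue : Fin n → Fin (suc m) → Bool → Set
  Venue i r b = Σ (Fin n) λ j → j ≢ i × rnd s i j ≡ r × home s i j ≡ b

  prevRound : Fin (suc m) → Fin (suc m)
  prevRound zero    = fromℕ m
  prevRound (suc r) = inject₁ r

  Break : Fin n → Fin (suc m) → Set
  Break i r = Σ Bool λ b → Venue i (prevRound r) b × Venue i r b

  SingleBreak : Set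
  SingleBreak = ∀ (i : Fin n) →
    Σ (Fin (suc m)) λ r → Break i r × (∀ r' → Break i r' → r' ≡ r)

  BreakRound : Fin (suc m) → Set
  BreakRound r = Σ (Fin n) λ i → Break i r

  -- ranking HAP of every team alternates: for consecutive opponents j < k of i
  -- (in increasing index order, i.e. no opponent strictly between them),
  -- i's venues against j and against k differ
  RankingFair : Set
  RankingFair = ∀ (i j k : Fin n) → j ≢ i → k ≢ i → j < k →
    (∀ (l : Fin n) → j < l → l < k → l ≡ i) →
    home s i j ≢ home s i k

rotate : ∀ {A : Set} {k : ℕ} → Vec A k → Vec A k
rotate []       = []
rotate (x ∷ xs) = xs ∷ʳ x

rotateN : ∀ {A : Set} {k : ℕ} → ℕ → Vec A k → Vec A k
rotateN zero    v = v
rotateN (suc t) v = rotate (rotateN t v)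

IsCyclicRotation : ∀ {A : Set} {k : ℕ} → Vec A k → Vec A k → Set
IsCyclicRotation u v = Σ ℕ λ t → v ≡ rotateN t u

RotOrRevRot : ∀ {A : Set} {k : ℕ} → Vec A k → Vec A k → Set
RotOrRevRot u v = IsCyclicRotation u v ⊎ Σ ℕ λ t → v ≡ reverse (rotateN t u)

HasCanonicalDSeq8 : Schedule 8 6 → Set
HasCanonicalDSeq8 s =
  Σ (Fin 7) λ r₁ → Σ (Fin 7) λ r₂ → Σ (Fin 7) λ r₃ → Σ (Fin 7) λ r₄ →
    r₁ < r₂ × r₂ < r₃ × r₃ < r₄ ×
    (∀ r → BreakRound s r ⇔ (r ≡ r₁ ⊎ r ≡ r₂ ⊎ r ≡ r₃ ⊎ r ≡ r₄)) ×
    RotOrRevRot (2 ∷ 2 ∷ 2 ∷ 1 ∷ [])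
      ((toℕ r₂ ∸ toℕ r₁) ∷ (toℕ r₃ ∸ toℕ r₂) ∷ (toℕ r₄ ∸ toℕ r₃)
        ∷ (toℕ r₁ + 7 ∸ toℕ r₄) ∷ [])

-- Ranking-fairness only concerns venues, and the parity rule "i hosts a weaker
-- opponent j iff i + j is even, and a stronger one iff i + j is odd" is
-- ranking-fair for every n: two consecutive opponents of i are either adjacent
-- indices on the same side of i (the parity of the index sum flips) or i - 1 and
-- i + 1 (the side flips, the parity does not).  It remains to find rounds for
-- which these venues give every team exactly one break, the breaks falling in
-- rounds 0, 2, 4, 6 (D-sequence (2, 2, 2, 1)); for the explicit 8-team table
-- feasibility and the break structure are decided by evaluation.
module Submission where

open import Defs
open import Data.Bool using (Bool; true; false; not; _xor_) renaming (_≟_ to _≟ᵇ_)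
open import Data.Bool.Properties using (not-¬; not-distribʳ-xor; not-distribˡ-xor)
open import Data.Fin using (Fin; toℕ; fromℕ<; _<_; #_)
open import Data.Fin.Properties using (toℕ-injective; toℕ-fromℕ<; toℕ<n; all?; any?; _≟_)
open import Data.Nat as ℕ using (ℕ; zero; suc; _+_; _<ᵇ_)
open import Data.Nat.Properties using (+-suc; +-comm; m≤n⇒m<n∨m≡n; n<1+n; m<n⇒m<1+n; <-trans; 1+n≢n; _<?_)
open import Data.Product using (Σ; _×_; _,_)
open import Data.Sum using (_⊎_; inj₁; inj₂; [_,_])
open import Data.Vec using (Vec; []; _∷_; lookup)
open import Function using (_∘_; _⇔_; mk⇔; Equivalence)
open import Relation.Binary.PropositionalEquality
  using (_≡_; _≢_; refl; sym; trans; cong; cong₂; subst; module ≡-Reasoning)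
open import Relation.Nullary using (Dec; contradiction)
open import Relation.Nullary.Decidable
  using (map′; from-yes; ¬?; _×-dec_; _⊎-dec_; _→-dec_)

even : ℕ → Bool
even zero    = true
even (suc n) = not (even n)

even-+-suc : ∀ a b → even (a + suc b) ≡ not (even (a + b))
even-+-suc a b = cong even (+-suc a b)

<ᵇ-flip : ∀ a b → a ≢ b → (a <ᵇ b) ≡ not (b <ᵇ a)
<ᵇ-flip zero    zero    a≢b = contradiction refl a≢b
<ᵇ-flip zero    (suc b) _   = refl
<ᵇ-flip (suc a) zero    _   = refl
<ᵇ-flip (suc a) (suc b) a≢b = <ᵇ-flip a b (a≢b ∘ cong suc)

1+m<ᵇn≡m<ᵇn : ∀ a b → a ≢ suc b → (suc b <ᵇ a) ≡ (b <ᵇ a)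
1+m<ᵇn≡m<ᵇn zero          b       _    = refl
1+m<ᵇn≡m<ᵇn (suc zero)    zero    a≢1  = contradiction refl a≢1
1+m<ᵇn≡m<ᵇn (suc (suc a)) zero    _    = refl
1+m<ᵇn≡m<ᵇn (suc a)       (suc b) a≢2+b = 1+m<ᵇn≡m<ᵇn a b (a≢2+b ∘ cong suc)

n<ᵇ1+n≡true : ∀ n → (n <ᵇ suc n) ≡ true
n<ᵇ1+n≡true zero    = refl
n<ᵇ1+n≡true (suc n) = n<ᵇ1+n≡true n

1+n<ᵇn≡false : ∀ n → (suc n <ᵇ n) ≡ false
1+n<ᵇn≡false zero    = refl
1+n<ᵇn≡false (suc n) = 1+n<ᵇn≡false n

≢-not : ∀ {x y} → y ≡ not x → x ≢ y
≢-not y≡¬x x≡y = not-¬ refl (trans x≡y y≡¬x)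

hosts : ℕ → ℕ → Bool
hosts a b = (b <ᵇ a) xor even (a + b)

hosts-flip : ∀ {a b} → a ≢ b → hosts b a ≡ not (hosts a b)
hosts-flip {a} {b} a≢b = begin
  (a <ᵇ b) xor even (b + a)        ≡⟨ cong₂ _xor_ (<ᵇ-flip a b a≢b) (cong even (+-comm b a)) ⟩
  not (b <ᵇ a) xor even (a + b)    ≡⟨ sym (not-distribˡ-xor (b <ᵇ a) _) ⟩
  not (hosts a b)                  ∎
  where open ≡-Reasoning

hosts-suc : ∀ a b → a ≢ suc b → hosts a (suc b) ≡ not (hosts a b)
hosts-suc a b a≢1+b = begin
  (suc b <ᵇ a) xor even (a + suc b)  ≡⟨ cong₂ _xor_ (1+m<ᵇn≡m<ᵇn a b a≢1+b) (even-+-suc a b) ⟩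
  (b <ᵇ a) xor not (even (a + b))    ≡⟨ sym (not-distribʳ-xor (b <ᵇ a) _) ⟩
  not (hosts a b)                    ∎
  where open ≡-Reasoning

hosts-across : ∀ b → hosts (suc b) (suc (suc b)) ≡ not (hosts (suc b) b)
hosts-across b
  rewrite 1+n<ᵇn≡false b | n<ᵇ1+n≡true b | even-+-suc b (suc b) | even-+-suc b b = refl

only-index-between : ∀ {n} {i j k : Fin n} → (∀ l → j < l → l < k → l ≡ i) →
  ∀ {x} → toℕ j ℕ.< x → x ℕ.< toℕ k → toℕ i ≡ x
only-index-between {i = i} {k = k} between {x} j<x x<k = begin
  toℕ i  ≡⟨ cong toℕ (sym (between l (subst (_ ℕ.<_) (sym l≡x) j<x) (subst (ℕ._< _) (sym l≡x) x<k))) ⟩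
  toℕ l  ≡⟨ l≡x ⟩
  x      ∎
  where
  open ≡-Reasoning
  x<n = <-trans x<k (toℕ<n k)
  l = fromℕ< x<n
  l≡x = toℕ-fromℕ< x<n

consecutive-opponents : ∀ {n} (i j k : Fin n) → j < k →
  (∀ l → j < l → l < k → l ≡ i) →
  toℕ k ≡ suc (toℕ j) ⊎ (toℕ i ≡ suc (toℕ j) × toℕ k ≡ suc (suc (toℕ j)))
consecutive-opponents i j k j<k between with m≤n⇒m<n∨m≡n j<k
... | inj₂ 1+j≡k = inj₁ (sym 1+j≡k)
... | inj₁ 1+j<k with m≤n⇒m<n∨m≡n 1+j<k | only-index-between between (n<1+n _) 1+j<k
...   | inj₂ 2+j≡k | i≡1+j = inj₂ (i≡1+j , sym 2+j≡k)
...   | inj₁ 2+j<k | i≡1+j =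
  contradiction (trans (sym i≡1+j) (only-index-between between (m<n⇒m<1+n (n<1+n _)) 2+j<k)) (1+n≢n ∘ sym)

parityHome : ∀ {n} → Fin n → Fin n → Bool
parityHome i j = hosts (toℕ i) (toℕ j)

parityHome-anti : ∀ {n} (i j : Fin n) → i ≢ j → parityHome i j ≢ parityHome j i
parityHome-anti i j i≢j = ≢-not (hosts-flip (i≢j ∘ toℕ-injective))

parityHome-alternates : ∀ {n} (i j k : Fin n) → k ≢ i → j < k →
  (∀ l → j < l → l < k → l ≡ i) → parityHome i j ≢ parityHome i k
parityHome-alternates i j k k≢i j<k between with consecutive-opponents i j k j<k between
... | inj₁ k≡1+j =
  subst (λ c → hosts (toℕ i) (toℕ j) ≢ hosts (toℕ i) c) (sym k≡1+j)
    (≢-not (hosts-suc (toℕ i) (toℕ j) λ i≡1+j → k≢i (toℕ-injective (trans k≡1+j (sym i≡1+j)))))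
... | inj₂ (i≡1+j , k≡2+j) rewrite i≡1+j | k≡2+j = ≢-not (hosts-across (toℕ j))

withParityHome : ∀ {n m} (r : Fin n → Fin n → Fin (suc m)) → (∀ i j → r i j ≡ r j i) →
  Schedule n m
withParityHome r r-sym = record
  { rnd = r ; home = parityHome ; rnd-sym = r-sym ; home-anti = parityHome-anti }

withParityHome-rankingFair : ∀ {n m} r r-sym → RankingFair (withParityHome {n} {m} r r-sym)
withParityHome-rankingFair _ _ i j k _ k≢i = parityHome-alternates i j k k≢i

Σ-Bool? : ∀ {p} {P : Bool → Set p} → (∀ b → Dec (P b)) → Dec (Σ Bool P)
Σ-Bool? P? = map′ [ (true ,_) , (false ,_) ] (λ { (true , p) → inj₁ p ; (false , p) → inj₂ p })
  (P? true ⊎-dec P? false)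

_⇔-dec_ : ∀ {a b} {A : Set a} {B : Set b} → Dec A → Dec B → Dec (A ⇔ B)
A? ⇔-dec B? = map′ (λ (f , g) → mk⇔ f g) (λ A⇔B → Equivalence.to A⇔B , Equivalence.from A⇔B)
  ((A? →-dec B?) ×-dec (B? →-dec A?))

module _ {n m : ℕ} (s : Schedule n m) where

  venue? : ∀ i r b → Dec (Venue s i r b)
  venue? i r b = any? λ j → ¬? (j ≟ i) ×-dec (rnd s i j ≟ r) ×-dec (home s i j ≟ᵇ b)

  break? : ∀ i r → Dec (Break s i r)
  break? i r = Σ-Bool? λ b → venue? i (prevRound s r) b ×-dec venue? i r b

  breakRound? : ∀ r → Dec (BreakRound s r)
  breakRound? r = any? λ i → break? i r

  feasible? : Dec (Feasible s)
  feasible? = all? λ i → all? λ r → any? λ j →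
    ¬? (j ≟ i) ×-dec (rnd s i j ≟ r) ×-dec
    all? λ j′ → ¬? (j′ ≟ i) →-dec (rnd s i j′ ≟ r) →-dec (j′ ≟ j)

  singleBreak? : Dec (SingleBreak s)
  singleBreak? = all? λ i → any? λ r → break? i r ×-dec all? λ r′ → break? i r′ →-dec (r′ ≟ r)

roundTable : Vec (Vec (Fin 7) 8) 8
roundTable =
  (# 0 ∷ # 6 ∷ # 0 ∷ # 1 ∷ # 5 ∷ # 2 ∷ # 3 ∷ # 4 ∷ []) ∷
  (# 6 ∷ # 0 ∷ # 5 ∷ # 4 ∷ # 0 ∷ # 1 ∷ # 2 ∷ # 3 ∷ []) ∷
  (# 0 ∷ # 5 ∷ # 0 ∷ # 6 ∷ # 3 ∷ # 4 ∷ # 1 ∷ # 2 ∷ []) ∷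
  (# 1 ∷ # 4 ∷ # 6 ∷ # 0 ∷ # 2 ∷ # 3 ∷ # 0 ∷ # 5 ∷ []) ∷
  (# 5 ∷ # 0 ∷ # 3 ∷ # 2 ∷ # 0 ∷ # 6 ∷ # 4 ∷ # 1 ∷ []) ∷
  (# 2 ∷ # 1 ∷ # 4 ∷ # 3 ∷ # 6 ∷ # 0 ∷ # 5 ∷ # 0 ∷ []) ∷
  (# 3 ∷ # 2 ∷ # 1 ∷ # 0 ∷ # 4 ∷ # 5 ∷ # 0 ∷ # 6 ∷ []) ∷
  (# 4 ∷ # 3 ∷ # 2 ∷ # 5 ∷ # 1 ∷ # 0 ∷ # 6 ∷ # 0 ∷ []) ∷
  []

round8 : Fin 8 → Fin 8 → Fin 7
round8 i j = lookup (lookup roundTable i) j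

round8-sym : ∀ i j → round8 i j ≡ round8 j i
round8-sym = from-yes (all? λ i → all? λ j → round8 i j ≟ round8 j i)

schedule8 : Schedule 8 6
schedule8 = withParityHome round8 round8-sym

breakRounds8 : ∀ r → BreakRound schedule8 r ⇔ (r ≡ # 0 ⊎ r ≡ # 2 ⊎ r ≡ # 4 ⊎ r ≡ # 6)
breakRounds8 = from-yes (all? λ r →
  breakRound? schedule8 r ⇔-dec ((r ≟ # 0) ⊎-dec (r ≟ # 2) ⊎-dec (r ≟ # 4) ⊎-dec (r ≟ # 6)))

theorem2 : Σ (Schedule 8 6) λ s →
    Feasible s × SingleBreak s × RankingFair s × HasCanonicalDSeq8 s
theorem2 =
  schedule8 ,
  from-yes (feasible? schedule8) ,
  from-yes (singleBreak? schedule8) ,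
  withParityHome-rankingFair round8 round8-sym ,
  (# 0 , # 2 , # 4 , # 6 , from-yes (0 <? 2) , from-yes (2 <? 4) , from-yes (4 <? 6) ,
   breakRounds8 , inj₁ (0 , refl))
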